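{- Every finite tournament $T$ in which every vertex has out-degree at least $2^{10}$ is $\frac{1}{2}$-majority $3$-colourable; that is, there is a map $c:V(T)\to\{1,2,3\}$ such that for every vertex $v$, the number of out-neighbours $w$ of $v$ with $c(w)=c(v)$ is at most $d^{+}(v)/2$, where $d^{+}(v)$ is the out-degree of $v$.
   Context: A tournament is a digraph in which for every pair of distinct vertices $u,v$ exactly one of the arcs $uv$, $vu$ is present. -}

module Defs where

open import Data.Nat using (ℕ; _+_; _*_; _≤_)
open import Data.Bool using (Bool; true; false; _∧_)
open import Data.Fin using (Fin)
open import Data.Fin.Properties using (_≟_)
open import Data.List using (List; length; allFin)
open import Data.List using () renaming (filterᵇ to filterᵇ)
open import Data.Sum using (_⊎_)
open import Relation.Binary.PropositionalEquality using (_≡_; _≢_)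
open import Relation.Nullary using (does)

Digraph : ℕ → Set
Digraph n = Fin n → Fin n → Bool

record IsTournament {n : ℕ} (T : Digraph n) : Set where
  field
    loopless   : ∀ u → T u u ≡ false
    total      : ∀ u v → u ≢ v → (T u v ≡ true) ⊎ (T v u ≡ true)
    asymmetric : ∀ u v → T u v ≡ true → T v u ≡ false

outdeg : ∀ {n} → Digraph n → Fin n → ℕ
outdeg {n} T v = length (filterᵇ (λ w → T v w) (allFin n))

sameOut : ∀ {n} → Digraph n → (Fin n → Fin 3) → Fin n → ℕ
sameOut {n} T c v = length (filterᵇ (λ w → T v w ∧ does (c w ≟ c v)) (allFin n))

-- c is a ½-majority colouring: sameOut ≤ d⁺(v)/2, i.e. 2·sameOut ≤ d⁺(v)
IsHalfMajorityColouring : ∀ {n} → Digraph n → (Fin n → Fin 3) → Set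
IsHalfMajorityColouring {n} T c = ∀ v → 2 * sameOut T c v ≤ outdeg T v

-- Count 3-colourings. Fix a vertex v of out-degree d and give a colouring c the weight
-- ∏ over the out-neighbours w of 9 if c w = c v and 4 otherwise. If s > d/2 out-neighbours share
-- the colour of v, the weight is 9^s 4^(d-s) ≥ 6^d; on the other hand, the total weight over all
-- colourings and all 3 possible colours of v factorises as 3·17^d·3^(n-d). So v is bad in at most
-- 3(17/18)^d 3^n colourings, which is at most 3^n / ((2d+1)(2d+2)) once d ≥ 300. In a tournament
-- the sum of 1/((2d⁺(v)+1)(2d⁺(v)+2)) over all n vertices is at most n/(n+1): the out-degrees sum
-- to n(n-1)/2, so some vertex has out-degree at least (n-1)/2, and removing it telescopes. Hence
-- fewer than 3^n colourings have a bad vertex.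

module Submission where

open import Defs
open import Data.Nat using (ℕ; _≤_; _^_)
open import Data.Fin using (Fin)
open import Data.Product using (∃)

open import Data.Bool using (Bool; true; false; not; _∧_; if_then_else_)
open import Data.Fin using (zero; suc; punchIn)
open import Data.Fin.Properties using (_≟_; suc-injective; punchIn-injective; 0≢1+n)
open import Data.List using (length; filterᵇ; tabulate)
open import Data.Nat using (zero; suc; _+_; _*_; _<_; _<ᵇ_; z≤n; s≤s; _≤′_; ≤′-refl; ≤′-step)
open import Data.Nat.Properties hiding (_≟_; suc-injective; 0≢1+n)
open import Data.Nat.Tactic.RingSolver using (solve-∀)
open import Data.Product using (_,_; map; map₂)
open import Data.Sum using (inj₁; inj₂)
open import Data.Vec.Functional using (Vector; []; _∷_)
open import Function using (_∘_; id)
open import Function.Definitions using (Injective)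
open import Relation.Binary.PropositionalEquality
open import Relation.Nullary using (does; yes; no; ofʸ; ofⁿ)

open import Algebra.Properties.Semiring.Sum +-*-semiring
  using (sum; sum-syntax; sum-cong-≗; ∑-distrib-+; ∑-comm; *-distribˡ-sum; *-distribʳ-sum; sum-remove)
open import Algebra.Properties.Monoid.Sum *-1-monoid
  using () renaming (sum to product; sum-cong-≗ to product-cong-≗)
open import Algebra.Properties.CommutativeSemigroup *-commutativeSemigroup using (x∙yz≈y∙xz; interchange)

-- Finite sums and counting

⟦_⟧ : Bool → ℕ
⟦ true ⟧ = 1
⟦ false ⟧ = 0

count : ∀ {n} → (Fin n → Bool) → ℕ
count {n} p = ∑[ i < n ] ⟦ p i ⟧

∑-const : ∀ n x → ∑[ i < n ] x ≡ n * x
∑-const zero x = refl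
∑-const (suc n) x = cong (x +_) (∑-const n x)

∑-mono-≤ : ∀ {n} {f g : Fin n → ℕ} → (∀ i → f i ≤ g i) → sum f ≤ sum g
∑-mono-≤ {zero} f≤g = z≤n
∑-mono-≤ {suc n} f≤g = +-mono-≤ (f≤g zero) (∑-mono-≤ (f≤g ∘ suc))

term≤∑ : ∀ {n} (f : Fin n → ℕ) i → f i ≤ sum f
term≤∑ f zero = m≤m+n _ _
term≤∑ f (suc i) = ≤-trans (term≤∑ (f ∘ suc) i) (m≤n+m _ _)

∑-<⇒∃< : ∀ {n} (f g : Fin n → ℕ) → sum f < sum g → ∃ λ i → f i < g i
∑-<⇒∃< {zero} f g ()
∑-<⇒∃< {suc n} f g f<g with f zero <? g zero
... | yes f₀<g₀ = zero , f₀<g₀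
... | no f₀≮g₀ = map suc id (∑-<⇒∃< (f ∘ suc) (g ∘ suc) (+-cancelˡ-< (f zero) _ _
                    (<-≤-trans f<g (+-monoˡ-≤ _ (≮⇒≥ f₀≮g₀)))))

length-filterᵇ-tabulate : ∀ {A : Set} {n} (p : A → Bool) (f : Fin n → A) →
  length (filterᵇ p (tabulate f)) ≡ count (p ∘ f)
length-filterᵇ-tabulate {n = zero} p f = refl
length-filterᵇ-tabulate {n = suc n} p f with p (f zero)
... | true = cong suc (length-filterᵇ-tabulate p (f ∘ suc))
... | false = length-filterᵇ-tabulate p (f ∘ suc)

count-split : ∀ {n} (p q : Fin n → Bool) →
  count p ≡ count (λ i → p i ∧ q i) + count (λ i → p i ∧ not (q i))
count-split p q =
  trans (sum-cong-≗ split) (∑-distrib-+ (λ i → ⟦ p i ∧ q i ⟧) (λ i → ⟦ p i ∧ not (q i) ⟧))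
  where
  split : ∀ i → ⟦ p i ⟧ ≡ ⟦ p i ∧ q i ⟧ + ⟦ p i ∧ not (q i) ⟧
  split i with p i | q i
  ... | true | true = refl
  ... | true | false = refl
  ... | false | _ = refl

count-+-count-not : ∀ {n} (b : Fin n → Bool) → count b + count (not ∘ b) ≡ n
count-+-count-not {zero} b = refl
count-+-count-not {suc n} b with b zero
... | true = cong suc (count-+-count-not (b ∘ suc))
... | false = trans (+-suc _ _) (cong suc (count-+-count-not (b ∘ suc)))

count-punchIn≤count : ∀ {n} (p : Fin (suc n) → Bool) v → count (p ∘ punchIn v) ≤ count p
count-punchIn≤count p v =
  ≤-trans (m≤n+m _ ⟦ p v ⟧) (≤-reflexive (sym (sum-remove {i = v} (λ w → ⟦ p w ⟧))))

product-if : ∀ {n} (x y : ℕ) (b : Fin n → Bool) →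
  product (λ i → if b i then x else y) ≡ x ^ count b * y ^ count (not ∘ b)
product-if {zero} x y b = refl
product-if {suc n} x y b =
  trans (cong ((if b zero then x else y) *_) (product-if x y (b ∘ suc))) (step (b zero) _ _)
  where
  step : ∀ b u w → (if b then x else y) * (x ^ u * y ^ w) ≡ x ^ (⟦ b ⟧ + u) * y ^ (⟦ not b ⟧ + w)
  step true u w = sym (*-assoc x (x ^ u) (y ^ w))
  step false u w = x∙yz≈y∙xz y (x ^ u) (y ^ w)

^-distribʳ-* : ∀ x y n → (x * y) ^ n ≡ x ^ n * y ^ n
^-distribʳ-* x y zero = refl
^-distribʳ-* x y (suc n) =
  trans (cong (x * y *_) (^-distribʳ-* x y n)) (interchange x y (x ^ n) (y ^ n))

-- Sums over all colourings

sumAll : ∀ {k n} → (Vector (Fin k) n → ℕ) → ℕ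
sumAll {k} {zero} F = F []
sumAll {k} {suc n} F = ∑[ a < k ] sumAll (λ c → F (a ∷ c))

sumAll-cong : ∀ {k n} {F G : Vector (Fin k) n → ℕ} → (∀ c → F c ≡ G c) → sumAll F ≡ sumAll G
sumAll-cong {n = zero} F≗G = F≗G []
sumAll-cong {n = suc n} F≗G = sum-cong-≗ λ a → sumAll-cong (λ c → F≗G (a ∷ c))

sumAll-mono-≤ : ∀ {k n} {F G : Vector (Fin k) n → ℕ} → (∀ c → F c ≤ G c) → sumAll F ≤ sumAll G
sumAll-mono-≤ {n = zero} F≤G = F≤G []
sumAll-mono-≤ {n = suc n} F≤G = ∑-mono-≤ λ a → sumAll-mono-≤ (λ c → F≤G (a ∷ c))

*-distribˡ-sumAll : ∀ {k n} x (F : Vector (Fin k) n → ℕ) → x * sumAll F ≡ sumAll (λ c → x * F c)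
*-distribˡ-sumAll {n = zero} x F = refl
*-distribˡ-sumAll {k} {suc n} x F = begin
  x * ∑[ a < k ] sumAll (λ c → F (a ∷ c))   ≡⟨ *-distribˡ-sum x (λ a → sumAll (λ c → F (a ∷ c))) ⟩
  ∑[ a < k ] (x * sumAll (λ c → F (a ∷ c))) ≡⟨ sum-cong-≗ (λ a → *-distribˡ-sumAll x (λ c → F (a ∷ c))) ⟩
  ∑[ a < k ] sumAll (λ c → x * F (a ∷ c))   ∎
  where open ≡-Reasoning

sumAll-∑-comm : ∀ {k n m} (F : Fin m → Vector (Fin k) n → ℕ) →
  sumAll (λ c → ∑[ v < m ] F v c) ≡ ∑[ v < m ] sumAll (F v)
sumAll-∑-comm {n = zero} F = refl
sumAll-∑-comm {k} {suc n} {m} F = begin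
  ∑[ a < k ] sumAll (λ c → ∑[ v < m ] F v (a ∷ c))  ≡⟨ sum-cong-≗ (λ a → sumAll-∑-comm (λ v c → F v (a ∷ c))) ⟩
  ∑[ a < k ] ∑[ v < m ] sumAll (λ c → F v (a ∷ c))  ≡⟨ ∑-comm (λ a v → sumAll (λ c → F v (a ∷ c))) ⟩
  ∑[ v < m ] ∑[ a < k ] sumAll (λ c → F v (a ∷ c))  ∎
  where open ≡-Reasoning

sumAll-product : ∀ {k n} (g : Fin n → Fin k → ℕ) →
  sumAll (λ c → product (λ i → g i (c i))) ≡ product (λ i → ∑[ a < k ] g i a)
sumAll-product {n = zero} g = refl
sumAll-product {k} {suc n} g = begin
  ∑[ a < k ] sumAll (λ c → g zero a * product (λ i → g (suc i) (c i)))
    ≡⟨ sum-cong-≗ (λ a → sym (*-distribˡ-sumAll (g zero a) (λ c → product (λ i → g (suc i) (c i))))) ⟩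
  ∑[ a < k ] (g zero a * sumAll (λ c → product (λ i → g (suc i) (c i))))
    ≡⟨ sum-cong-≗ (λ a → cong (g zero a *_) (sumAll-product (g ∘ suc))) ⟩
  ∑[ a < k ] (g zero a * product (λ i → ∑[ b < k ] g (suc i) b))
    ≡⟨ *-distribʳ-sum (product (λ i → ∑[ b < k ] g (suc i) b)) (g zero) ⟨
  (∑[ a < k ] g zero a) * product (λ i → ∑[ b < k ] g (suc i) b) ∎
  where open ≡-Reasoning

sumAll-1 : ∀ k n → sumAll {k} {n} (λ _ → 1) ≡ k ^ n
sumAll-1 k zero = refl
sumAll-1 k (suc n) = trans (sum-cong-≗ {k} (λ _ → sumAll-1 k n)) (∑-const k (k ^ n))

sumAll-<⇒∃< : ∀ {k n} (F G : Vector (Fin k) n → ℕ) → sumAll F < sumAll G → ∃ λ c → F c < G c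
sumAll-<⇒∃< {n = zero} F G F<G = [] , F<G
sumAll-<⇒∃< {k} {suc n} F G F<G with ∑-<⇒∃< _ _ F<G
... | a , Fₐ<Gₐ = map (a ∷_) id (sumAll-<⇒∃< (λ c → F (a ∷ c)) (λ c → G (a ∷ c)) Fₐ<Gₐ)

-- Colourings in which a vertex is bad

tilt : Bool → Bool → ℕ
tilt false _ = 1
tilt true true = 9
tilt true false = 4

product-tilt : ∀ {n} (p q : Fin n → Bool) →
  product (λ i → tilt (p i) (q i)) ≡ 9 ^ count (λ i → p i ∧ q i) * 4 ^ count (λ i → p i ∧ not (q i))
product-tilt {zero} p q = refl
product-tilt {suc n} p q =
  trans (cong (tilt (p zero) (q zero) *_) (product-tilt (p ∘ suc) (q ∘ suc))) (step (p zero) (q zero) _ _)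
  where
  step : ∀ b c x y → tilt b c * (9 ^ x * 4 ^ y) ≡ 9 ^ (⟦ b ∧ c ⟧ + x) * 4 ^ (⟦ b ∧ not c ⟧ + y)
  step true true x y = sym (*-assoc 9 (9 ^ x) (4 ^ y))
  step true false x y = x∙yz≈y∙xz 4 (9 ^ x) (4 ^ y)
  step false c x y = *-identityˡ (9 ^ x * 4 ^ y)

6^[s+y]≤9^s*4^y : ∀ s y → y ≤ s → 6 ^ (s + y) ≤ 9 ^ s * 4 ^ y
6^[s+y]≤9^s*4^y s zero _ = begin
  6 ^ (s + 0)  ≡⟨ cong (6 ^_) (+-identityʳ s) ⟩
  6 ^ s        ≤⟨ ^-monoˡ-≤ s (≤ᵇ⇒≤ 6 9 _) ⟩
  9 ^ s        ≡⟨ *-identityʳ (9 ^ s) ⟨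
  9 ^ s * 1    ∎
  where open ≤-Reasoning
6^[s+y]≤9^s*4^y (suc s) (suc y) (s≤s y≤s) = begin
  6 ^ (suc s + suc y)      ≡⟨ cong (λ e → 6 * 6 ^ e) (+-suc s y) ⟩
  6 * (6 * 6 ^ (s + y))    ≡⟨ *-assoc 6 6 (6 ^ (s + y)) ⟨
  36 * 6 ^ (s + y)         ≤⟨ *-monoʳ-≤ 36 (6^[s+y]≤9^s*4^y s y y≤s) ⟩
  36 * (9 ^ s * 4 ^ y)     ≡⟨ 36*[x*y]≡9x*4y (9 ^ s) (4 ^ y) ⟩
  9 ^ suc s * 4 ^ suc y    ∎
  where
  open ≤-Reasoning
  36*[x*y]≡9x*4y : ∀ x y → 36 * (x * y) ≡ (9 * x) * (4 * y)
  36*[x*y]≡9x*4y = solve-∀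

agreements : ∀ {n} → (Fin n → Bool) → Vector (Fin 3) n → Fin 3 → ℕ
agreements N c a = count (λ w → N w ∧ does (c w ≟ a))

weight : ∀ {n} → (Fin n → Bool) → Vector (Fin 3) n → Fin 3 → ℕ
weight N c a = product (λ w → tilt (N w) (does (c w ≟ a)))

majority⇒6^d≤weight : ∀ {n} (N : Fin n → Bool) c a →
  count N < 2 * agreements N c a → 6 ^ count N ≤ weight N c a
majority⇒6^d≤weight {n} N c a majority = begin
  6 ^ count N  ≡⟨ cong (6 ^_) d≡s+y ⟩
  6 ^ (s + y)  ≤⟨ 6^[s+y]≤9^s*4^y s y (<⇒≤ y<s) ⟩
  9 ^ s * 4 ^ y ≡⟨ product-tilt N agrees ⟨
  weight N c a ∎
  where
  open ≤-Reasoning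
  agrees : Fin n → Bool
  agrees w = does (c w ≟ a)
  s y : ℕ
  s = agreements N c a
  y = count (λ w → N w ∧ not (agrees w))
  d≡s+y : count N ≡ s + y
  d≡s+y = count-split N agrees
  y<s : y < s
  y<s = +-cancelˡ-< s y s (subst₂ _<_ d≡s+y (cong (s +_) (+-identityʳ s)) majority)

∑-tilt : ∀ b a → ∑[ x < 3 ] tilt b (does (x ≟ a)) ≡ (if b then 17 else 3)
∑-tilt true zero = refl
∑-tilt true (suc zero) = refl
∑-tilt true (suc (suc zero)) = refl
∑-tilt false a = refl

sumAll-weight : ∀ {n} (N : Fin n → Bool) a →
  sumAll (λ c → weight N c a) ≡ 17 ^ count N * 3 ^ count (not ∘ N)
sumAll-weight N a = begin
  sumAll (λ c → product (λ w → tilt (N w) (does (c w ≟ a))))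
    ≡⟨ sumAll-product (λ w x → tilt (N w) (does (x ≟ a))) ⟩
  product (λ w → ∑[ x < 3 ] tilt (N w) (does (x ≟ a)))
    ≡⟨ product-cong-≗ (λ w → ∑-tilt (N w) a) ⟩
  product (λ w → if N w then 17 else 3)
    ≡⟨ product-if 17 3 N ⟩
  17 ^ count N * 3 ^ count (not ∘ N) ∎
  where open ≡-Reasoning

majorityColourings-bound : ∀ {n} (N : Fin n → Bool) (v : Fin n) →
  sumAll (λ c → ⟦ count N <ᵇ 2 * agreements N c (c v) ⟧) * 6 ^ count N
    ≤ 3 * (17 ^ count N * 3 ^ count (not ∘ N))
majorityColourings-bound {n} N v = begin
  sumAll majority * 6 ^ d                   ≡⟨ *-comm (sumAll majority) (6 ^ d) ⟩
  6 ^ d * sumAll majority                   ≡⟨ *-distribˡ-sumAll (6 ^ d) majority ⟩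
  sumAll (λ c → 6 ^ d * majority c)         ≤⟨ sumAll-mono-≤ majority≤weight ⟩
  sumAll (λ c → weight N c (c v))           ≤⟨ sumAll-mono-≤ (λ c → term≤∑ (weight N c) (c v)) ⟩
  sumAll (λ c → ∑[ a < 3 ] weight N c a)    ≡⟨ sumAll-∑-comm (λ a c → weight N c a) ⟩
  ∑[ a < 3 ] sumAll (λ c → weight N c a)    ≡⟨ sum-cong-≗ (sumAll-weight N) ⟩
  ∑[ a < 3 ] (17 ^ d * 3 ^ count (not ∘ N)) ≡⟨ ∑-const 3 (17 ^ d * 3 ^ count (not ∘ N)) ⟩
  3 * (17 ^ d * 3 ^ count (not ∘ N))        ∎
  where
  open ≤-Reasoning
  d : ℕ
  d = count N
  majority : Vector (Fin 3) n → ℕ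
  majority c = ⟦ d <ᵇ 2 * agreements N c (c v) ⟧
  majority≤weight : ∀ c → 6 ^ d * majority c ≤ weight N c (c v)
  majority≤weight c with d <ᵇ 2 * agreements N c (c v) | <ᵇ-reflects-< d (2 * agreements N c (c v))
  ... | true | ofʸ d<2s = ≤-trans (≤-reflexive (*-identityʳ (6 ^ d))) (majority⇒6^d≤weight N c (c v) d<2s)
  ... | false | _ = ≤-trans (≤-reflexive (*-zeroʳ (6 ^ d))) z≤n

-- The numerical estimate

q : ℕ → ℕ
q d = (2 * d + 1) * (2 * d + 2)

q-mono-≤ : ∀ {d e} → d ≤ e → q d ≤ q e
q-mono-≤ d≤e = *-mono-≤ (+-monoˡ-≤ 1 (*-monoʳ-≤ 2 d≤e)) (+-monoˡ-≤ 2 (*-monoʳ-≤ 2 d≤e))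

m[1+m]≤q : ∀ {m d} → m ≤ 2 * d + 1 → m * suc m ≤ q d
m[1+m]≤q {d = d} m≤2d+1 = *-mono-≤ m≤2d+1 (≤-trans (s≤s m≤2d+1) (≤-reflexive (sym (+-suc (2 * d) 1))))

17q[1+d]≤18q[d] : ∀ d → 300 ≤ d → 17 * q (suc d) ≤ 18 * q d
17q[1+d]≤18q[d] d 300≤d = +-cancelʳ-≤ (4 * d * d) (17 * q (suc d)) (18 * q d) (begin
  17 * q (suc d) + 4 * d * d  ≡⟨ expand d ⟨
  18 * q d + (130 * d + 168)  ≤⟨ +-monoʳ-≤ (18 * q d) linear≤quadratic ⟩
  18 * q d + 4 * d * d        ∎)
  where
  open ≤-Reasoning
  expand : ∀ d → 18 * ((2 * d + 1) * (2 * d + 2)) + (130 * d + 168)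
                 ≡ 17 * ((2 * suc d + 1) * (2 * suc d + 2)) + 4 * d * d
  expand = solve-∀
  linear≤quadratic : 130 * d + 168 ≤ 4 * d * d
  linear≤quadratic = begin
    130 * d + 168  ≤⟨ +-monoʳ-≤ (130 * d) (≤-trans (≤ᵇ⇒≤ 168 300 _) 300≤d) ⟩
    130 * d + d    ≡⟨ +-comm (130 * d) d ⟩
    131 * d        ≤⟨ *-monoˡ-≤ d (≤-trans (≤ᵇ⇒≤ 131 1200 _) (*-monoʳ-≤ 4 300≤d)) ⟩
    4 * d * d      ∎

3q[d]17^d≤18^d : ∀ d → 300 ≤ d → 3 * q d * 17 ^ d ≤ 18 ^ d
3q[d]17^d≤18^d d 300≤d = from300 (≤⇒≤′ 300≤d)
  where
  from300 : ∀ {d} → 300 ≤′ d → 3 * q d * 17 ^ d ≤ 18 ^ d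
  from300 ≤′-refl = ≤ᵇ⇒≤ _ _ _
  from300 (≤′-step {d} 300≤′d) = begin
    3 * q (suc d) * (17 * 17 ^ d)    ≡⟨ reorder (q (suc d)) (17 ^ d) ⟩
    (17 * q (suc d)) * (3 * 17 ^ d)  ≤⟨ *-monoˡ-≤ (3 * 17 ^ d) (17q[1+d]≤18q[d] d (≤′⇒≤ 300≤′d)) ⟩
    (18 * q d) * (3 * 17 ^ d)        ≡⟨ regroup (q d) (17 ^ d) ⟩
    18 * (3 * q d * 17 ^ d)          ≤⟨ *-monoʳ-≤ 18 (from300 300≤′d) ⟩
    18 * 18 ^ d                      ∎
    where
    open ≤-Reasoning
    reorder : ∀ x y → 3 * x * (17 * y) ≡ (17 * x) * (3 * y)
    reorder = solve-∀
    regroup : ∀ x y → (18 * x) * (3 * y) ≡ 18 * (3 * x * y)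
    regroup = solve-∀

-- Tournaments

-- 1/((n+1)(n+2)) + n/(n+1) = (n+1)/(n+2), with the denominators cleared.
telescoping-step : ∀ n b s K → b * (suc n * suc (suc n)) ≤ K → suc n * s ≤ n * K →
  suc (suc n) * (b + s) ≤ suc n * K
telescoping-step n b s K b-bound s-bound = *-cancelˡ-≤ (suc n) (begin
  suc n * (suc (suc n) * (b + s))                   ≡⟨ expand n b s ⟩
  b * (suc n * suc (suc n)) + suc (suc n) * (suc n * s)
    ≤⟨ +-mono-≤ b-bound (*-monoʳ-≤ (suc (suc n)) s-bound) ⟩
  K + suc (suc n) * (n * K)                         ≡⟨ collect n K ⟩
  suc n * (suc n * K)                               ∎)
  where
  open ≤-Reasoning
  expand : ∀ n b s →
    suc n * (suc (suc n) * (b + s)) ≡ b * (suc n * suc (suc n)) + suc (suc n) * (suc n * s)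
  expand = solve-∀
  collect : ∀ n K → K + suc (suc n) * (n * K) ≡ suc n * (suc n * K)
  collect = solve-∀

restrict-tournament : ∀ {m n} {T : Digraph n} → IsTournament T →
  (f : Fin m → Fin n) → Injective _≡_ _≡_ f → IsTournament (λ i j → T (f i) (f j))
restrict-tournament isT f f-injective = record
  { loopless = λ i → loopless (f i)
  ; total = λ i j i≢j → total (f i) (f j) (i≢j ∘ f-injective)
  ; asymmetric = λ i j → asymmetric (f i) (f j)
  }
  where open IsTournament isT

exactlyOneArc : ∀ {n} {T : Digraph n} → IsTournament T → ∀ {u w} → u ≢ w → ⟦ T u w ⟧ + ⟦ T w u ⟧ ≡ 1
exactlyOneArc isT {u} {w} u≢w with IsTournament.total isT u w u≢w
... | inj₁ uw rewrite uw | IsTournament.asymmetric isT u w uw = refl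
... | inj₂ wu rewrite wu | IsTournament.asymmetric isT w u wu = refl

∑-outdegree-suc : ∀ {n} {T : Digraph (suc n)} → IsTournament T →
  ∑[ v < suc n ] count (T v) ≡ n + ∑[ i < n ] count (λ j → T (suc i) (suc j))
∑-outdegree-suc {n} {T} isT = begin
  (⟦ T zero zero ⟧ + out₀) + ∑[ i < n ] (in₀ i + count (T′ i))
    ≡⟨ cong (λ b → (⟦ b ⟧ + out₀) + ∑[ i < n ] (in₀ i + count (T′ i))) (IsTournament.loopless isT zero) ⟩
  out₀ + ∑[ i < n ] (in₀ i + count (T′ i))
    ≡⟨ cong (out₀ +_) (∑-distrib-+ in₀ (count ∘ T′)) ⟩
  out₀ + (sum in₀ + ∑[ i < n ] count (T′ i))
    ≡⟨ +-assoc out₀ (sum in₀) _ ⟨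
  (out₀ + sum in₀) + ∑[ i < n ] count (T′ i)
    ≡⟨ cong (_+ ∑[ i < n ] count (T′ i)) arcs-at-zero ⟩
  n + ∑[ i < n ] count (T′ i) ∎
  where
  open ≡-Reasoning
  T′ : Digraph n
  T′ i j = T (suc i) (suc j)
  out₀ : ℕ
  out₀ = count (T zero ∘ suc)
  in₀ : Fin n → ℕ
  in₀ i = ⟦ T (suc i) zero ⟧
  arcs-at-zero : out₀ + sum in₀ ≡ n
  arcs-at-zero = begin
    out₀ + sum in₀                                ≡⟨ ∑-distrib-+ (λ i → ⟦ T zero (suc i) ⟧) in₀ ⟨
    ∑[ i < n ] (⟦ T zero (suc i) ⟧ + in₀ i)       ≡⟨ sum-cong-≗ {n} (λ i → exactlyOneArc isT (0≢1+n {i = i})) ⟩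
    ∑[ i < n ] 1                                  ≡⟨ ∑-const n 1 ⟩
    n * 1                                         ≡⟨ *-identityʳ n ⟩
    n                                             ∎

∑-outdegree : ∀ {n} {T : Digraph n} → IsTournament T → 2 * ∑[ v < n ] count (T v) + n ≡ n * n
∑-outdegree {zero} isT = refl
∑-outdegree {suc n} {T} isT = begin
  2 * ∑[ v < suc n ] count (T v) + suc n  ≡⟨ cong (λ s → 2 * s + suc n) (∑-outdegree-suc isT) ⟩
  2 * (n + S′) + suc n                    ≡⟨ regroup n S′ ⟩
  (2 * S′ + n) + (2 * n + 1)              ≡⟨ cong (_+ (2 * n + 1)) ih ⟩
  n * n + (2 * n + 1)                     ≡⟨ square n ⟩
  suc n * suc n                           ∎
  where
  open ≡-Reasoning
  S′ : ℕ
  S′ = ∑[ i < n ] count (λ j → T (suc i) (suc j))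
  ih : 2 * S′ + n ≡ n * n
  ih = ∑-outdegree (restrict-tournament isT suc suc-injective)
  regroup : ∀ n s → 2 * (n + s) + suc n ≡ (2 * s + n) + (2 * n + 1)
  regroup = solve-∀
  square : ∀ n → n * n + (2 * n + 1) ≡ suc n * suc n
  square = solve-∀

∃-outdegree≥half : ∀ {n} {T : Digraph (suc n)} → IsTournament T → ∃ λ v → suc n ≤ 2 * count (T v) + 1
∃-outdegree≥half {n} {T} isT =
  map₂ (λ {v} → n<2d+2⇒n≤2d+1 v) (∑-<⇒∃< (λ _ → suc n) (λ v → 2 * count (T v) + 2) average)
  where
  S : ℕ
  S = ∑[ v < suc n ] count (T v)
  average : ∑[ v < suc n ] suc n < ∑[ v < suc n ] (2 * count (T v) + 2)
  average = begin-strict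
    ∑[ v < suc n ] suc n                    ≡⟨ ∑-const (suc n) (suc n) ⟩
    suc n * suc n                           ≡⟨ ∑-outdegree isT ⟨
    2 * S + suc n                           <⟨ +-monoʳ-< (2 * S) (m<m*n (suc n) 2 (s≤s (s≤s z≤n))) ⟩
    2 * S + suc n * 2                       ≡⟨ cong₂ _+_ (*-distribˡ-sum 2 (count ∘ T)) (sym (∑-const (suc n) 2)) ⟩
    ∑[ v < suc n ] (2 * count (T v)) + ∑[ v < suc n ] 2 ≡⟨ ∑-distrib-+ (λ v → 2 * count (T v)) (λ _ → 2) ⟨
    ∑[ v < suc n ] (2 * count (T v) + 2)    ∎
    where open ≤-Reasoning
  n<2d+2⇒n≤2d+1 : ∀ v → suc n < 2 * count (T v) + 2 → suc n ≤ 2 * count (T v) + 1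
  n<2d+2⇒n≤2d+1 v n<2d+2 = m<1+n⇒m≤n (subst (suc n <_) (+-suc (2 * count (T v)) 1) n<2d+2)

tournament-weights : ∀ {n} {T : Digraph n} → IsTournament T → (B : Fin n → ℕ) (K : ℕ) →
  (∀ v → B v * q (count (T v)) ≤ K) → suc n * sum B ≤ n * K
tournament-weights {zero} isT B K B-bound = z≤n
tournament-weights {suc n} {T} isT B K B-bound = remove (∃-outdegree≥half isT)
  where
  open ≤-Reasoning
  remove : ∃ (λ v → suc n ≤ 2 * count (T v) + 1) → suc (suc n) * sum B ≤ suc n * K
  remove (v , n≤2d+1) = begin
    suc (suc n) * sum B                       ≡⟨ cong (suc (suc n) *_) (sum-remove {i = v} B) ⟩
    suc (suc n) * (B v + sum (B ∘ punchIn v)) ≤⟨ telescoping-step n (B v) _ K v-bound rest-bound ⟩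
    suc n * K                                 ∎
    where
    v-bound : B v * (suc n * suc (suc n)) ≤ K
    v-bound = ≤-trans (*-monoʳ-≤ (B v) (m[1+m]≤q {d = count (T v)} n≤2d+1)) (B-bound v)
    rest-bound : suc n * sum (B ∘ punchIn v) ≤ n * K
    rest-bound = tournament-weights (restrict-tournament isT (punchIn v) (punchIn-injective v _ _))
      (B ∘ punchIn v) K λ i → ≤-trans
        (*-monoʳ-≤ (B (punchIn v i)) (q-mono-≤ (count-punchIn≤count (T (punchIn v i)) v)))
        (B-bound (punchIn v i))

tournament-weights-< : ∀ {n} {T : Digraph n} → IsTournament T → (B : Fin n → ℕ) (K : ℕ) → 0 < K →
  (∀ v → B v * q (count (T v)) ≤ K) → sum B < K
tournament-weights-< {n} isT B K 0<K B-bound = ≰⇒> λ K≤∑B → <⇒≱ 0<K (+-cancelʳ-≤ (n * K) K 0 (begin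
  K + n * K    ≤⟨ *-monoʳ-≤ (suc n) K≤∑B ⟩
  suc n * sum B ≤⟨ tournament-weights isT B K B-bound ⟩
  n * K        ∎))
  where open ≤-Reasoning

isBad : ∀ {n} → Digraph n → (Fin n → Fin 3) → Fin n → Bool
isBad T c v = outdeg T v <ᵇ 2 * sameOut T c v

outdeg≡count : ∀ {n} (T : Digraph n) v → outdeg T v ≡ count (T v)
outdeg≡count T v = length-filterᵇ-tabulate (T v) id

sameOut≡agreements : ∀ {n} (T : Digraph n) c v → sameOut T c v ≡ agreements (T v) c (c v)
sameOut≡agreements T c v = length-filterᵇ-tabulate (λ w → T v w ∧ does (c w ≟ c v)) id

badColourings : ∀ {n} → Digraph n → Fin n → ℕ
badColourings T v = sumAll (λ c → ⟦ isBad T c v ⟧)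

badColourings-bound : ∀ {n} (T : Digraph n) v → 300 ≤ count (T v) →
  badColourings T v * q (count (T v)) ≤ 3 ^ n
badColourings-bound {n} T v 300≤d = *-cancelʳ-≤ _ (3 ^ n) (18 ^ d) {{m^n≢0 18 d}} (begin
  B * q d * 18 ^ d                      ≡⟨ cong (B * q d *_) (^-distribʳ-* 6 3 d) ⟩
  B * q d * (6 ^ d * 3 ^ d)             ≡⟨ interchange B (q d) (6 ^ d) (3 ^ d) ⟩
  (B * 6 ^ d) * (q d * 3 ^ d)           ≤⟨ *-monoˡ-≤ (q d * 3 ^ d) B*6^d≤ ⟩
  3 * (17 ^ d * 3 ^ e) * (q d * 3 ^ d)  ≡⟨ regroup (17 ^ d) (3 ^ e) (q d) (3 ^ d) ⟩
  (3 * q d * 17 ^ d) * (3 ^ d * 3 ^ e)  ≤⟨ *-mono-≤ (3q[d]17^d≤18^d d 300≤d) (≤-reflexive 3^d3^e≡3^n) ⟩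
  18 ^ d * 3 ^ n                        ≡⟨ *-comm (18 ^ d) (3 ^ n) ⟩
  3 ^ n * 18 ^ d                        ∎)
  where
  open ≤-Reasoning
  d e B : ℕ
  d = count (T v)
  e = count (not ∘ T v)
  B = badColourings T v
  B*6^d≤ : B * 6 ^ d ≤ 3 * (17 ^ d * 3 ^ e)
  B*6^d≤ = subst (λ x → x * 6 ^ d ≤ 3 * (17 ^ d * 3 ^ e))
    (sumAll-cong λ c → sym (cong₂ (λ x y → ⟦ x <ᵇ 2 * y ⟧) (outdeg≡count T v) (sameOut≡agreements T c v)))
    (majorityColourings-bound (T v) v)
  3^d3^e≡3^n : 3 ^ d * 3 ^ e ≡ 3 ^ n
  3^d3^e≡3^n = trans (sym (^-distribˡ-+-* 3 d e)) (cong (3 ^_) (count-+-count-not (T v)))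
  regroup : ∀ x y z w → 3 * (x * y) * (z * w) ≡ (3 * z * x) * (w * y)
  regroup = solve-∀

⟦m<ᵇn⟧<1⇒n≤m : ∀ m n → ⟦ m <ᵇ n ⟧ < 1 → n ≤ m
⟦m<ᵇn⟧<1⇒n≤m m n with m <ᵇ n | <ᵇ-reflects-< m n
... | true | _ = λ { (s≤s ()) }
... | false | ofⁿ m≮n = λ _ → ≮⇒≥ m≮n

theorem3 : ∀ (n : ℕ) (T : Digraph n) → IsTournament T →
    (∀ v → 2 ^ 10 ≤ outdeg T v) →
    ∃ λ (c : Fin n → Fin 3) → IsHalfMajorityColouring T c
theorem3 n T isT deg = map₂ (λ {c} → noBad⇒good c) (sumAll-<⇒∃< badVertices (λ _ → 1) fewBad)
  where
  badVertices : (Fin n → Fin 3) → ℕ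
  badVertices c = ∑[ v < n ] ⟦ isBad T c v ⟧
  300≤d : ∀ v → 300 ≤ count (T v)
  300≤d v = ≤-trans (≤ᵇ⇒≤ 300 (2 ^ 10) _) (subst (2 ^ 10 ≤_) (outdeg≡count T v) (deg v))
  fewBad : sumAll badVertices < sumAll {3} {n} (λ _ → 1)
  fewBad = subst₂ _<_ (sym (sumAll-∑-comm λ v c → ⟦ isBad T c v ⟧)) (sym (sumAll-1 3 n))
    (tournament-weights-< isT (badColourings T) (3 ^ n) (m^n>0 3 n)
      λ v → badColourings-bound T v (300≤d v))
  noBad⇒good : ∀ c → badVertices c < 1 → IsHalfMajorityColouring T c
  noBad⇒good c noBad v =
    ⟦m<ᵇn⟧<1⇒n≤m (outdeg T v) _ (≤-<-trans (term≤∑ (λ w → ⟦ isBad T c w ⟧) v) noBad)
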